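{- Let $r\ge 1$ and let $K_C$ be the $r$-dimensional cocycle complex associated with a cycle $C$ of length $\ell$ (on a vertex set $V$ with $|V|=r+3$). Then $K_C$ is $1$-neighbor uniform.
   Context: The cocycle complex $K_C$ associated with a cycle $C$ whose vertices lie in a set $V$ of size $r+3$ is the simplicial complex on $V$ whose $r$-faces (facets) are exactly $V\setminus e$ for $e\in E(C)$, together with all subsets. For an $r$-dimensional complex $K$, an $r$-face $F$ and a vertex $u\notin F$, let $N^{\mathrm d}(F,u)=\{G\cup\{u\}\in S_r(K): G\subset F,\ |G|=r\}$, where $S_r(K)$ is the set of $r$-faces (faces of size $r+1$). $K$ is $t$-neighbor uniform if $|N^{\mathrm d}(F,u)|=t$ for every $r$-face $F$ and every vertex $u$ of $K$ not in $F$. -}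

module Defs where

open import Data.Nat using (ℕ; zero; suc)
open import Data.Fin using (Fin; toℕ)
open import Data.Fin.Subset using (Subset; _∈_; _∉_; _⊆_; ⁅_⁆; _∪_; ∁; ∣_∣)
open import Data.Product using (Σ; ∃; ∃₂; _×_)
open import Data.Sum using (_⊎_)
open import Data.List using (List; length)
open import Data.List.Relation.Unary.Unique.Propositional using (Unique)
import Data.List.Membership.Propositional as LM
open import Function.Bundles using (_⇔_)
open import Relation.Binary.PropositionalEquality using (_≡_)

Complex : ℕ → Set₁
Complex n = Subset n → Set

CycleAdj : (ℓ : ℕ) → Fin ℓ → Fin ℓ → Set
CycleAdj ℓ i j = (suc (toℕ i) ≡ toℕ j) ⊎ ((suc (toℕ i) ≡ ℓ) × (toℕ j ≡ 0))

-- A cycle C of length ℓ in V = Fin n is given by an injective map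
-- vs : Fin ℓ → Fin n (its vertices in cyclic order); its edges are the
-- 2-sets {vs i, vs (i+1 mod ℓ)}.
IsEdgeOf : {n : ℕ} (ℓ : ℕ) → (Fin ℓ → Fin n) → Subset n → Set
IsEdgeOf ℓ vs e = ∃₂ λ i j → CycleAdj ℓ i j × (e ≡ ⁅ vs i ⁆ ∪ ⁅ vs j ⁆)

CocycleComplex : {n : ℕ} (ℓ : ℕ) → (Fin ℓ → Fin n) → Complex n
CocycleComplex ℓ vs F = ∃ λ e → IsEdgeOf ℓ vs e × (F ⊆ ∁ e)

IsRFace : {n : ℕ} → ℕ → Complex n → Subset n → Set
IsRFace r K F = K F × (∣ F ∣ ≡ suc r)

IsVertex : {n : ℕ} → Complex n → Fin n → Set
IsVertex K u = ∃ λ F → K F × (u ∈ F)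

InDownNeighborhood : {n : ℕ} → ℕ → Complex n → Subset n → Fin n → Subset n → Set
InDownNeighborhood r K F u H =
  IsRFace r K H × (∃ λ G → (G ⊆ F) × (∣ G ∣ ≡ r) × (H ≡ G ∪ ⁅ u ⁆))

HasCardinality : {n : ℕ} → (Subset n → Set) → ℕ → Set
HasCardinality {n} P t =
  Σ (List (Subset n)) λ xs → Unique xs × (length xs ≡ t) × (∀ H → (P H ⇔ LM._∈_ H xs))

NeighborUniform : {n : ℕ} → ℕ → ℕ → Complex n → Set
NeighborUniform r t K =
  ∀ F u → IsRFace r K F → IsVertex K u → u ∉ F →
    HasCardinality (InDownNeighborhood r K F u) t

-- An r-face F of K_C has r + 1 = |V| - 2 elements, so it is the complement of an
-- edge {vs k, vs m} of C, and a vertex u ∉ F is an endpoint, say u = vs k. A member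
-- G ∪ {vs k} of N^d(F, vs k) is again the complement of an edge e'; it contains vs k
-- but not vs m, so e' joins m to a neighbor of m other than k. On a cycle of length
-- at least 3 that neighbor k' is unique, so N^d(F, vs k) = {∁{vs m, vs k'}}, and this
-- face does arise, from G = ∁{vs m, vs k'} - vs k.
module Submission where

open import Defs
open import Data.Nat using (ℕ; _+_; _≤_; _<_; suc; _∸_; s≤s; s≤s⁻¹)
import Data.Nat.Properties as ℕ
open import Data.Fin using (Fin; zero; suc; toℕ; fromℕ; fromℕ<; inject₁)
open import Data.Fin.Properties using (toℕ-injective; toℕ<n; toℕ-fromℕ; toℕ-fromℕ<; toℕ-inject₁)
open import Data.Fin.Subset using (Subset; _∈_; _∉_; _⊆_; ⁅_⁆; _∪_; ∁; ∣_∣; _─_; _-_; inside; outside)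
open import Data.Fin.Subset.Properties
open import Data.Vec using (_∷_; here; there)
open import Data.Product using (∃; ∃₂; _×_; _,_)
open import Data.Sum using (_⊎_; inj₁; inj₂; [_,_]′)
import Data.Sum as Sum
open import Data.List using ([_])
open import Data.List.Relation.Unary.All using ([])
open import Data.List.Relation.Unary.AllPairs using ([]; _∷_)
open import Data.List.Relation.Unary.Any using (here)
open import Function using (_∘_)
open import Function.Bundles using (_⇔_; mk⇔; Equivalence)
open import Function.Definitions using (Injective)
open import Relation.Nullary using (¬_; yes; no; contradiction)
open import Relation.Binary.PropositionalEquality using (_≡_; _≢_; refl; sym; trans; cong; subst)

private
  variable
    n ℓ : ℕ
    p q : Subset n
    x y z : Fin n
    i j k : Fin ℓ

⊆∧∣≡∣⇒≡ : p ⊆ q → ∣ p ∣ ≡ ∣ q ∣ → p ≡ q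
⊆∧∣≡∣⇒≡ {p = p} {q} p⊆q ∣p∣≡∣q∣ = ⊆-antisym p⊆q q⊆p
  where
  q⊆p : q ⊆ p
  q⊆p {x} x∈q with x ∈? p
  ... | yes x∈p = x∈p
  ... | no x∉p = contradiction ∣p∣≡∣q∣ (ℕ.<⇒≢ (p⊂q⇒∣p∣<∣q∣ (p⊆q , x , x∈q , x∉p)))

x∈p─q⇒x∉q : x ∈ p ─ q → x ∉ q
x∈p─q⇒x∉q {p = _ ∷ _} {inside ∷ _} () here
x∈p─q⇒x∉q {p = _ ∷ _} {outside ∷ _} here ()
x∈p─q⇒x∉q {p = _ ∷ _} {_ ∷ _} (there x∈p─q) (there x∈q) = x∈p─q⇒x∉q x∈p─q x∈q

x∈p⇒∣p-x∣+1≡∣p∣ : x ∈ p → suc ∣ p - x ∣ ≡ ∣ p ∣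
x∈p⇒∣p-x∣+1≡∣p∣ {x = zero} {p = inside ∷ p} here = cong (suc ∘ ∣_∣) (p─⊥≡p p)
x∈p⇒∣p-x∣+1≡∣p∣ {x = suc _} {p = inside ∷ _} (there x∈p) = cong suc (x∈p⇒∣p-x∣+1≡∣p∣ x∈p)
x∈p⇒∣p-x∣+1≡∣p∣ {x = suc _} {p = outside ∷ _} (there x∈p) = x∈p⇒∣p-x∣+1≡∣p∣ x∈p

x∈p⇒p-x∪⁅x⁆≡p : x ∈ p → (p - x) ∪ ⁅ x ⁆ ≡ p
x∈p⇒p-x∪⁅x⁆≡p {x = zero} {p = inside ∷ p} here =
  cong (inside ∷_) (trans (∪-identityʳ (p ─ _)) (p─⊥≡p p))
x∈p⇒p-x∪⁅x⁆≡p {x = suc _} {p = inside ∷ _} (there x∈p) = cong (inside ∷_) (x∈p⇒p-x∪⁅x⁆≡p x∈p)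
x∈p⇒p-x∪⁅x⁆≡p {x = suc _} {p = outside ∷ _} (there x∈p) = cong (outside ∷_) (x∈p⇒p-x∪⁅x⁆≡p x∈p)

x∈⁅y⁆∪⁅z⁆⇒x≡y⊎x≡z : x ∈ ⁅ y ⁆ ∪ ⁅ z ⁆ → x ≡ y ⊎ x ≡ z
x∈⁅y⁆∪⁅z⁆⇒x≡y⊎x≡z {y = y} {z} = Sum.map (x∈⁅y⁆⇒x≡y y) (x∈⁅y⁆⇒x≡y z) ∘ x∈p∪q⁻ ⁅ y ⁆ ⁅ z ⁆

x≢y∧x≢z⇒x∈∁⁅y⁆∪⁅z⁆ : x ≢ y → x ≢ z → x ∈ ∁ (⁅ y ⁆ ∪ ⁅ z ⁆)
x≢y∧x≢z⇒x∈∁⁅y⁆∪⁅z⁆ x≢y x≢z = x∉p⇒x∈∁p ([ x≢y , x≢z ]′ ∘ x∈⁅y⁆∪⁅z⁆⇒x≡y⊎x≡z)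

x∈∁⁅y⁆∪⁅z⁆⇒x≢y : x ∈ ∁ (⁅ y ⁆ ∪ ⁅ z ⁆) → x ≢ y
x∈∁⁅y⁆∪⁅z⁆⇒x≢y x∈ refl = x∈∁p⇒x∉p x∈ (x∈p∪q⁺ (inj₁ (x∈⁅x⁆ _)))

x∈∁⁅y⁆∪⁅z⁆⇒x≢z : x ∈ ∁ (⁅ y ⁆ ∪ ⁅ z ⁆) → x ≢ z
x∈∁⁅y⁆∪⁅z⁆⇒x≢z x∈ refl = x∈∁p⇒x∉p x∈ (x∈p∪q⁺ (inj₂ (x∈⁅x⁆ _)))

∣⁅x⁆∪⁅y⁆∣≡2 : x ≢ y → ∣ ⁅ x ⁆ ∪ ⁅ y ⁆ ∣ ≡ 2
∣⁅x⁆∪⁅y⁆∣≡2 {x = zero} {zero} x≢y = contradiction refl x≢y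
∣⁅x⁆∪⁅y⁆∣≡2 {x = zero} {suc y} _ =
  trans (cong (suc ∘ ∣_∣) (∪-identityˡ ⁅ y ⁆)) (cong suc (∣⁅x⁆∣≡1 y))
∣⁅x⁆∪⁅y⁆∣≡2 {x = suc x} {zero} _ =
  trans (cong (suc ∘ ∣_∣) (∪-identityʳ ⁅ x ⁆)) (cong suc (∣⁅x⁆∣≡1 x))
∣⁅x⁆∪⁅y⁆∣≡2 {x = suc _} {suc _} x≢y = ∣⁅x⁆∪⁅y⁆∣≡2 (x≢y ∘ cong suc)

∣∁⁅x⁆∪⁅y⁆∣≡n∸2 : {x y : Fin n} → x ≢ y → ∣ ∁ (⁅ x ⁆ ∪ ⁅ y ⁆) ∣ ≡ n ∸ 2
∣∁⁅x⁆∪⁅y⁆∣≡n∸2 {n} {x} {y} x≢y =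
  trans (∣∁p∣≡n∸∣p∣ (⁅ x ⁆ ∪ ⁅ y ⁆)) (cong (n ∸_) (∣⁅x⁆∪⁅y⁆∣≡2 x≢y))

hasCardinality-singleton : {P : Subset n → Set} (a : Subset n) →
  (∀ H → P H ⇔ H ≡ a) → HasCardinality P 1
hasCardinality-singleton a P⇔≡a = [ a ] , [] ∷ [] , refl , λ H →
  mk⇔ (here ∘ Equivalence.to (P⇔≡a H)) (λ { (here H≡a) → Equivalence.from (P⇔≡a H) H≡a })

Adjacent : (ℓ : ℕ) → Fin ℓ → Fin ℓ → Set
Adjacent ℓ i j = CycleAdj ℓ i j ⊎ CycleAdj ℓ j i

Adjacent-sym : Adjacent ℓ i j → Adjacent ℓ j i
Adjacent-sym = Sum.swap

CycleAdj-functional : CycleAdj ℓ i j → CycleAdj ℓ i k → j ≡ k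
CycleAdj-functional (inj₁ 1+i≡j) (inj₁ 1+i≡k) = toℕ-injective (trans (sym 1+i≡j) 1+i≡k)
CycleAdj-functional {j = j} (inj₁ 1+i≡j) (inj₂ (1+i≡ℓ , _)) =
  contradiction (trans (sym 1+i≡j) 1+i≡ℓ) (ℕ.<⇒≢ (toℕ<n j))
CycleAdj-functional {k = k} (inj₂ (1+i≡ℓ , _)) (inj₁ 1+i≡k) =
  contradiction (trans (sym 1+i≡k) 1+i≡ℓ) (ℕ.<⇒≢ (toℕ<n k))
CycleAdj-functional (inj₂ (_ , j≡0)) (inj₂ (_ , k≡0)) = toℕ-injective (trans j≡0 (sym k≡0))

CycleAdj-injective : CycleAdj ℓ i k → CycleAdj ℓ j k → i ≡ j
CycleAdj-injective (inj₁ 1+i≡k) (inj₁ 1+j≡k) =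
  toℕ-injective (ℕ.suc-injective (trans 1+i≡k (sym 1+j≡k)))
CycleAdj-injective (inj₁ 1+i≡k) (inj₂ (_ , k≡0)) = contradiction (trans 1+i≡k k≡0) λ ()
CycleAdj-injective (inj₂ (_ , k≡0)) (inj₁ 1+j≡k) = contradiction (trans 1+j≡k k≡0) λ ()
CycleAdj-injective (inj₂ (1+i≡ℓ , _)) (inj₂ (1+j≡ℓ , _)) =
  toℕ-injective (ℕ.suc-injective (trans 1+i≡ℓ (sym 1+j≡ℓ)))

CycleAdj-irrefl : 1 < ℓ → ¬ CycleAdj ℓ i i
CycleAdj-irrefl _ (inj₁ 1+i≡i) = ℕ.1+n≢n 1+i≡i
CycleAdj-irrefl 1<ℓ (inj₂ (1+i≡ℓ , i≡0)) = ℕ.<⇒≢ 1<ℓ (trans (sym (cong suc i≡0)) 1+i≡ℓ)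

CycleAdj-asym : 2 < ℓ → CycleAdj ℓ i j → ¬ CycleAdj ℓ j i
CycleAdj-asym {i = i} _ (inj₁ 1+i≡j) (inj₁ 1+j≡i) =
  ℕ.m≢1+n+m (toℕ i) (sym (trans (cong suc 1+i≡j) 1+j≡i))
CycleAdj-asym 2<ℓ (inj₁ 1+i≡j) (inj₂ (1+j≡ℓ , i≡0)) =
  ℕ.<⇒≢ 2<ℓ (trans (cong suc (trans (sym (cong suc i≡0)) 1+i≡j)) 1+j≡ℓ)
CycleAdj-asym 2<ℓ (inj₂ (1+i≡ℓ , j≡0)) (inj₁ 1+j≡i) =
  ℕ.<⇒≢ 2<ℓ (trans (cong suc (trans (sym (cong suc j≡0)) 1+j≡i)) 1+i≡ℓ)
CycleAdj-asym 2<ℓ (inj₂ (_ , j≡0)) (inj₂ (1+j≡ℓ , _)) =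
  ℕ.<⇒≢ (ℕ.<-trans (ℕ.n<1+n 1) 2<ℓ) (trans (sym (cong suc j≡0)) 1+j≡ℓ)

Adjacent-irrefl : 1 < ℓ → ¬ Adjacent ℓ i i
Adjacent-irrefl 1<ℓ = [ CycleAdj-irrefl 1<ℓ , CycleAdj-irrefl 1<ℓ ]′

predecessor : (j : Fin ℓ) → ∃ λ i → CycleAdj ℓ i j
predecessor {suc ℓ} zero = fromℕ ℓ , inj₂ (cong suc (toℕ-fromℕ ℓ) , refl)
predecessor (suc j) = inject₁ j , inj₁ (cong suc (toℕ-inject₁ j))

successor : (i : Fin ℓ) → ∃ λ j → CycleAdj ℓ i j
successor {suc ℓ} i with toℕ i ℕ.≟ ℓ
... | yes i≡ℓ = zero , inj₂ (cong suc i≡ℓ , refl)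
... | no i≢ℓ = fromℕ< 1+i<1+ℓ , inj₁ (sym (toℕ-fromℕ< 1+i<1+ℓ))
  where
  1+i<1+ℓ : suc (toℕ i) < suc ℓ
  1+i<1+ℓ = s≤s (ℕ.≤∧≢⇒< (s≤s⁻¹ (toℕ<n i)) i≢ℓ)

record OtherNeighbor {ℓ : ℕ} (k m : Fin ℓ) : Set where
  field
    other : Fin ℓ
    other-adjacent : Adjacent ℓ other m
    other≢ : other ≢ k
    other-unique : ∀ {x} → Adjacent ℓ x m → x ≢ k → x ≡ other

otherNeighbor : {k m : Fin ℓ} → 2 < ℓ → Adjacent ℓ k m → OtherNeighbor k m
otherNeighbor {m = m} 2<ℓ (inj₁ k→m) with successor m
... | k' , m→k' = record
  { other = k'
  ; other-adjacent = inj₂ m→k'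
  ; other≢ = λ { refl → CycleAdj-asym 2<ℓ k→m m→k' }
  ; other-unique = λ
      { (inj₁ x→m) x≢k → contradiction (CycleAdj-injective x→m k→m) x≢k
      ; (inj₂ m→x) _ → CycleAdj-functional m→x m→k'
      }
  }
otherNeighbor {m = m} 2<ℓ (inj₂ m→k) with predecessor m
... | k' , k'→m = record
  { other = k'
  ; other-adjacent = inj₁ k'→m
  ; other≢ = λ { refl → CycleAdj-asym 2<ℓ k'→m m→k }
  ; other-unique = λ
      { (inj₁ x→m) _ → CycleAdj-injective x→m k'→m
      ; (inj₂ m→x) x≢k → contradiction (CycleAdj-functional m→x m→k) x≢k
      }
  }

module CocycleComplexOfCycle {r ℓ : ℕ} (2<ℓ : 2 < ℓ) (vs : Fin ℓ → Fin (r + 3))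
                             (vs-injective : Injective _≡_ _≡_ vs) where

  K : Complex (r + 3)
  K = CocycleComplex ℓ vs

  coedge : Fin ℓ → Fin ℓ → Subset (r + 3)
  coedge i j = ∁ (⁅ vs i ⁆ ∪ ⁅ vs j ⁆)

  coedge-comm : ∀ i j → coedge i j ≡ coedge j i
  coedge-comm i j = cong ∁ (∪-comm ⁅ vs i ⁆ ⁅ vs j ⁆)

  ∉coedge⇒endpoint : x ∉ coedge i j → x ≡ vs i ⊎ x ≡ vs j
  ∉coedge⇒endpoint = x∈⁅y⁆∪⁅z⁆⇒x≡y⊎x≡z ∘ x∉∁p⇒x∈p

  adjacent⇒vs≢ : Adjacent ℓ i j → vs i ≢ vs j
  adjacent⇒vs≢ {j = j} i~j vsi≡vsj =
    Adjacent-irrefl (ℕ.<-trans (ℕ.n<1+n 1) 2<ℓ)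
                    (subst (λ i → Adjacent ℓ i j) (vs-injective vsi≡vsj) i~j)

  ∣coedge∣≡r+1 : Adjacent ℓ i j → ∣ coedge i j ∣ ≡ suc r
  ∣coedge∣≡r+1 i~j = trans (∣∁⁅x⁆∪⁅y⁆∣≡n∸2 (adjacent⇒vs≢ i~j)) (cong (_∸ 2) (ℕ.+-comm r 3))

  coedge-isRFace : Adjacent ℓ i j → IsRFace r K (coedge i j)
  coedge-isRFace i~j@(inj₁ i→j) = (_ , (_ , _ , i→j , refl) , ⊆-refl) , ∣coedge∣≡r+1 i~j
  coedge-isRFace {i} {j} i~j@(inj₂ j→i) =
    (_ , (_ , _ , j→i , refl) , ⊆-reflexive (coedge-comm i j)) , ∣coedge∣≡r+1 i~j

  isRFace⇒coedge : {F : Subset (r + 3)} → IsRFace r K F →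
                   ∃₂ λ i j → CycleAdj ℓ i j × F ≡ coedge i j
  isRFace⇒coedge ((_ , (i , j , i→j , refl) , F⊆) , ∣F∣≡r+1) =
    i , j , i→j , ⊆∧∣≡∣⇒≡ F⊆ (trans ∣F∣≡r+1 (sym (∣coedge∣≡r+1 (inj₁ i→j))))

  module _ {k m : Fin ℓ} (k~m : Adjacent ℓ k m) where
    open OtherNeighbor (otherNeighbor 2<ℓ k~m) renaming (other to k')

    coedge-∈-downNeighborhood : InDownNeighborhood r K (coedge k m) (vs k) (coedge m k')
    coedge-∈-downNeighborhood =
      coedge-isRFace m~k' , coedge m k' - vs k , G⊆F , ∣G∣≡r , sym (x∈p⇒p-x∪⁅x⁆≡p vsk∈coedge)
      where
      m~k' : Adjacent ℓ m k'
      m~k' = Adjacent-sym other-adjacent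
      vsk∈coedge : vs k ∈ coedge m k'
      vsk∈coedge = x≢y∧x≢z⇒x∈∁⁅y⁆∪⁅z⁆ (adjacent⇒vs≢ k~m) (other≢ ∘ vs-injective ∘ sym)
      G⊆F : coedge m k' - vs k ⊆ coedge k m
      G⊆F x∈G = x≢y∧x≢z⇒x∈∁⁅y⁆∪⁅z⁆
        (x∉⁅y⁆⇒x≢y (x∈p─q⇒x∉q x∈G))
        (x∈∁⁅y⁆∪⁅z⁆⇒x≢y (p─q⊆p (coedge m k') _ x∈G))
      ∣G∣≡r : ∣ coedge m k' - vs k ∣ ≡ r
      ∣G∣≡r = ℕ.suc-injective (trans (x∈p⇒∣p-x∣+1≡∣p∣ vsk∈coedge) (∣coedge∣≡r+1 m~k'))

    downNeighborhood-unique : ∀ {H} → InDownNeighborhood r K (coedge k m) (vs k) H →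
                              H ≡ coedge m k'
    downNeighborhood-unique (H-face , G , G⊆F , _ , refl) with isRFace⇒coedge H-face
    ... | i , j , i→j , H≡coedge = trans H≡coedge (through-m m≡i⊎m≡j)
      where
      vsk∈coedge : vs k ∈ coedge i j
      vsk∈coedge = subst (vs k ∈_) H≡coedge (x∈p∪q⁺ (inj₂ (x∈⁅x⁆ (vs k))))
      vsm∉coedge : vs m ∉ coedge i j
      vsm∉coedge vsm∈coedge with x∈p∪q⁻ G ⁅ vs k ⁆ (subst (vs m ∈_) (sym H≡coedge) vsm∈coedge)
      ... | inj₁ vsm∈G = x∈∁⁅y⁆∪⁅z⁆⇒x≢z (G⊆F vsm∈G) refl
      ... | inj₂ vsm∈⁅vsk⁆ = adjacent⇒vs≢ k~m (sym (x∈⁅y⁆⇒x≡y (vs k) vsm∈⁅vsk⁆))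
      m≡i⊎m≡j : m ≡ i ⊎ m ≡ j
      m≡i⊎m≡j = Sum.map vs-injective vs-injective (∉coedge⇒endpoint vsm∉coedge)
      i≢k : i ≢ k
      i≢k refl = x∈∁⁅y⁆∪⁅z⁆⇒x≢y vsk∈coedge refl
      j≢k : j ≢ k
      j≢k refl = x∈∁⁅y⁆∪⁅z⁆⇒x≢z vsk∈coedge refl
      through-m : m ≡ i ⊎ m ≡ j → coedge i j ≡ coedge m k'
      through-m (inj₁ refl) = cong (coedge m) (other-unique (inj₂ i→j) j≢k)
      through-m (inj₂ refl) =
        trans (coedge-comm i m) (cong (coedge m) (other-unique (inj₁ i→j) i≢k))

    downNeighborhood-hasCardinality-1 :
      HasCardinality (InDownNeighborhood r K (coedge k m) (vs k)) 1
    downNeighborhood-hasCardinality-1 = hasCardinality-singleton (coedge m k') λ H →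
      mk⇔ downNeighborhood-unique λ { refl → coedge-∈-downNeighborhood }

  neighborUniform : NeighborUniform r 1 K
  neighborUniform F u F-face _ u∉F with isRFace⇒coedge F-face
  ... | i , j , i→j , refl with ∉coedge⇒endpoint u∉F
  ... | inj₁ refl = downNeighborhood-hasCardinality-1 (inj₁ i→j)
  ... | inj₂ refl = subst (λ F → HasCardinality (InDownNeighborhood r K F (vs j)) 1)
                          (coedge-comm j i) (downNeighborhood-hasCardinality-1 (inj₂ i→j))

lemma3p2 : (r : ℕ) → 1 ≤ r → (ℓ : ℕ) → 3 ≤ ℓ →
    (vs : Fin ℓ → Fin (r + 3)) → Injective _≡_ _≡_ vs →
    NeighborUniform r 1 (CocycleComplex ℓ vs)
lemma3p2 _ _ _ 3≤ℓ vs vs-injective = CocycleComplexOfCycle.neighborUniform 3≤ℓ vs vs-injective
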